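{- Let $I=\widehat O\cup\bigcup_{k=1}^h\{a_k,b_k,c_k\}$ be an $(\alpha,\beta,3)$-ANI instance with capacity $W$ such that $w_{a_k}\ge W/2$ and $w_{a_k}>w_{b_k}\ge w_{c_k}$ for all $k$. Let $k\in\{1,\dots,h\}$ be such that there is no full pattern containing $a_k$ whose other items all lie in $I\setminus\{a_k,b_k,c_k\}$. Then every full pattern $P$ containing $a_k$ either contains an item of weight $w_{c_k}$, or has the property that every ordered tuple representation of $P$ admits a suffix of total weight $w_{c_k}$. Consequently, $w_{c_k}$ is a mandatory weight for $a_k$.
   Context: A Bin Packing instance consists of a finite set $I$ of items with positive integer weights $w_i$ and a positive integer capacity $W$. A full pattern is a subset $P\subseteq I$ with $\sum_{i\in P}w_i=W$. For an instance $J$, $z_{\mathrm{ILP}}^J$ is the minimum number of bins into which $J$ can be partitioned, and $z_{\mathrm{LP}}^J$ the optimal value of the linear relaxation of the set covering formulation $\min\sum_P x_P$ s.t. $\sum_P a_{iP}x_P\ge1$ for every item $i$, $x\ge0$, over all multisets $P$ of items of total weight at most $W$. $I$ is an $(\alpha,\beta,3)$-ANI instance if its items can be partitioned as $I=\widehat O\cup\bigcup_{k=1}^h\{a_k,b_k,c_k\}$ with $|\widehat O|=\alpha$, $\sum_{i\in\widehat O}w_i=\beta W$, $z_{\mathrm{LP}}^{\widehat O}=\beta$, $z_{\mathrm{ILP}}^{\widehat O}=\beta+1$, $w_{a_k}+w_{b_k}+w_{c_k}=W$ for each $k$, and for each $k$ no subset $S\subseteq\widehat O\cup\{a_g,b_g,c_g:g<k\}$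 satisfies $\sum_{i\in S}w_i+w_{a_k}=W$. An ordered tuple representation of a pattern $P$ is a listing $(t_1,\dots,t_o)$ of its items in non-increasing order of weight, ties broken arbitrarily; a suffix is a contiguous subsequence $(t_{o-s+1},\dots,t_o)$ with $1\le s\le o$. A weight $w$ is mandatory for an item $a$ if every full pattern $P$ containing $a$ contains either an item other than $a$ of weight $w$ or a subset of $P\setminus\{a\}$ of total weight $w$. -}

module Defs where

open import Data.Nat using (ℕ; zero; suc; _+_; _*_; _≤_; _<_)
open import Data.Bool using (Bool; true; false; if_then_else_)
open import Data.Fin using (Fin; toℕ; _≟_)
open import Data.List using (List; []; _∷_; _++_; map; concatMap; allFin)
open import Data.Nat.ListAction using (sum)
open import Data.List.Membership.Propositional using (_∈_)
open import Data.List.Relation.Unary.Unique.Propositional using (Unique)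
open import Data.List.Relation.Unary.Linked using (Linked)
open import Data.Product using (Σ; ∃; ∃₂; _×_; _,_; proj₁)
open import Data.Sum using (_⊎_)
open import Data.Unit using (⊤)
open import Relation.Nullary using (¬_)
open import Relation.Nullary.Decidable using (⌊_⌋)
open import Relation.Binary.PropositionalEquality using (_≡_; _≢_)
open import Data.Integer using (+_)
import Data.Rational as Q

sumFin : ∀ {n} → (Fin n → ℕ) → ℕ
sumFin {n} f = sum (map f (allFin n))

load : ∀ {n m} → (Fin n → ℕ) → (Fin n → Fin m) → Fin m → ℕ
load v f j = sumFin (λ i → if ⌊ f i ≟ j ⌋ then v i else 0)

PackableInto : ∀ {n} → (Fin n → ℕ) → ℕ → ℕ → Set
PackableInto {n} v W m = Σ (Fin n → Fin m) λ f → ∀ j → load v f j ≤ W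

IsZILP : ∀ {n} → (Fin n → ℕ) → ℕ → ℕ → Set
IsZILP v W z = PackableInto v W z × (∀ m → m < z → ¬ PackableInto v W m)

-- A pattern of the set-covering formulation: a multiset of items,
-- given by multiplicities, of total weight at most W.
Pattern : ∀ {n} → (Fin n → ℕ) → ℕ → Set
Pattern {n} v W = Σ (Fin n → ℕ) λ p → sumFin (λ i → p i * v i) ≤ W

ℕtoℚ : ℕ → Q.ℚ
ℕtoℚ k = (+ k) Q./ 1

-- A (finite-support) LP solution: a list of patterns with nonnegative
-- rational coefficients x_P.
LPSol : ∀ {n} → (Fin n → ℕ) → ℕ → Set
LPSol v W = List (Pattern v W × Q.ℚ)

coeffsNonneg : ∀ {n} {v : Fin n → ℕ} {W} → LPSol v W → Set
coeffsNonneg [] = ⊤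
coeffsNonneg ((P , x) ∷ s) = (Q.0ℚ Q.≤ x) × coeffsNonneg s

coverage : ∀ {n} {v : Fin n → ℕ} {W} → LPSol v W → Fin n → Q.ℚ
coverage [] i = Q.0ℚ
coverage ((P , x) ∷ s) i = (ℕtoℚ (proj₁ P i) Q.* x) Q.+ coverage s i

lpValue : ∀ {n} {v : Fin n → ℕ} {W} → LPSol v W → Q.ℚ
lpValue [] = Q.0ℚ
lpValue ((P , x) ∷ s) = x Q.+ lpValue s

LPFeasible : ∀ {n} {v : Fin n → ℕ} {W} → LPSol v W → Set
LPFeasible {n} s = coeffsNonneg s × (∀ (i : Fin n) → Q.1ℚ Q.≤ coverage s i)

IsZLP : ∀ {n} → (Fin n → ℕ) → ℕ → Q.ℚ → Set
IsZLP v W z =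
  (Σ (LPSol v W) λ s → LPFeasible s × lpValue s ≡ z) ×
  (∀ (s : LPSol v W) → LPFeasible s → z Q.≤ lpValue s)

data Item (α h : ℕ) : Set where
  o : Fin α → Item α h
  a : Fin h → Item α h
  b : Fin h → Item α h
  c : Fin h → Item α h

allItems : ∀ α h → List (Item α h)
allItems α h = map o (allFin α) ++ concatMap (λ k → a k ∷ b k ∷ c k ∷ []) (allFin h)

Subset : ℕ → ℕ → Set
Subset α h = Item α h → Bool

weightOf : ∀ {α h} → (Item α h → ℕ) → Subset α h → ℕ
weightOf {α} {h} w S = sum (map (λ i → if S i then w i else 0) (allItems α h))

FullPattern : ∀ {α h} → (Item α h → ℕ) → ℕ → Subset α h → Set
FullPattern w W P = weightOf w P ≡ W

EarlierOrO : ∀ {α h} → Fin h → Item α h → Set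
EarlierOrO k (o _) = ⊤
EarlierOrO k (a g) = toℕ g < toℕ k
EarlierOrO k (b g) = toℕ g < toℕ k
EarlierOrO k (c g) = toℕ g < toℕ k

IsANI : ∀ α β h → (Item α h → ℕ) → ℕ → Set
IsANI α β h w W =
  (0 < W) ×
  (∀ i → 0 < w i) ×
  (sumFin (λ i → w (o i)) ≡ β * W) ×
  IsZLP (λ i → w (o i)) W (ℕtoℚ β) ×
  IsZILP (λ i → w (o i)) W (suc β) ×
  (∀ k → w (a k) + w (b k) + w (c k) ≡ W) ×
  (∀ k (S : Subset α h) → (∀ i → S i ≡ true → EarlierOrO k i) →
      weightOf w S + w (a k) ≢ W)

InTriple : ∀ {α h} → Fin h → Item α h → Set
InTriple k i = (i ≡ a k) ⊎ (i ≡ b k) ⊎ (i ≡ c k)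

OrderedTuple : ∀ {α h} → (Item α h → ℕ) → Subset α h → List (Item α h) → Set
OrderedTuple w P t =
  Unique t × (∀ i → (i ∈ t → P i ≡ true) × (P i ≡ true → i ∈ t)) ×
  Linked (λ x y → w y ≤ w x) t

HasSuffixOfWeight : ∀ {α h} → (Item α h → ℕ) → List (Item α h) → ℕ → Set
HasSuffixOfWeight w t v =
  ∃₂ λ pre suf → (pre ++ suf ≡ t) × (suf ≢ []) × (sum (map w suf) ≡ v)

Mandatory : ∀ {α h} → (Item α h → ℕ) → ℕ → ℕ → Item α h → Set
Mandatory {α} {h} w W v x =
  ∀ (P : Subset α h) → FullPattern w W P → P x ≡ true →
    (∃ λ i → i ≢ x × P i ≡ true × w i ≡ v) ⊎
    (∃ λ (S : Subset α h) →
        (∀ i → S i ≡ true → P i ≡ true × i ≢ x) × weightOf w S ≡ v)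

-- Let P be a full pattern through a_k. The hypothesis on k forces b_k or c_k into P; if b_k is in P,
-- the items of P other than a_k and b_k weigh W − w(a_k) − w(b_k) = w(c_k), so w(c_k) is mandatory.
-- In an ordered tuple of such a P the first item is a_k: any other first item weighs at least w(a_k)
-- and, together with a_k and b_k, would exceed W ≤ 2 w(a_k). If w(c_k) < w(b_k), the second item is
-- b_k for the same reason, as the items after a_k weigh only w(b_k) + w(c_k) < 2 w(b_k). The items
-- after a_k and b_k then form a suffix of weight w(c_k).
module Submission where

open import Defs
open import Data.Nat using (ℕ; _+_; _*_; _≤_; _<_; _≟_)
open import Data.Nat.Properties
open import Data.Nat.ListAction using (sum)
open import Algebra.Properties.CommutativeSemigroup +-commutativeSemigroup
  using () renaming (interchange to +-interchange)
open import Data.Bool using (true; false; if_then_else_; _∧_; not)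
open import Data.Bool.Properties using (∧-identityʳ)
open import Data.Fin using (Fin) renaming (_≟_ to _≟ᶠ_)
open import Data.Maybe using (Maybe; just; nothing)
open import Data.Maybe.Properties using (just-injective)
open import Data.List using (List; []; _∷_; map; concatMap; allFin)
open import Data.List.Properties using (map-cong)
open import Data.List.Membership.Propositional using (_∈_; _∉_)
open import Data.List.Membership.Propositional.Properties
  using (∈-allFin; ∈-map⁺; ∈-map⁻; ∈-++⁺ˡ; ∈-++⁺ʳ; ∈-++⁻; ∈-concat⁺′)
open import Data.List.Relation.Unary.Any using (here; there)
import Data.List.Relation.Unary.Any as Any
import Data.List.Relation.Unary.All as All
import Data.List.Relation.Unary.All.Properties as All
import Data.List.Relation.Unary.AllPairs as AllPairs
import Data.List.Relation.Unary.AllPairs.Properties as AllPairs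
open import Data.List.Relation.Unary.Linked using (Linked; _∷_)
import Data.List.Relation.Unary.Linked as Linked
open import Data.List.Relation.Unary.Linked.Properties using (Linked⇒AllPairs)
open import Data.List.Relation.Unary.Unique.Propositional using (Unique)
open import Data.List.Relation.Unary.Unique.Propositional.Properties using (map⁺; ++⁺; concat⁺; allFin⁺)
open import Data.List.Relation.Binary.Disjoint.Propositional using (Disjoint)
open import Data.Product using (Σ; ∃; _×_; _,_; proj₁; proj₂)
open import Data.Sum using (_⊎_; inj₁; inj₂)
open import Data.Empty using (⊥-elim)
open import Function using (_∘_; case_of_)
open import Relation.Nullary using (¬_; yes; no)
open import Relation.Nullary.Decidable using (⌊_⌋; map′)
open import Relation.Binary.Definitions using (DecidableEquality)
open import Relation.Binary.PropositionalEquality using (_≡_; _≢_; refl; sym; trans; cong; cong₂; subst)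
open Relation.Binary.PropositionalEquality.≡-Reasoning

module _ {A : Set} where

  sum-map-+ : (f g : A → ℕ) → ∀ xs → sum (map (λ x → f x + g x) xs) ≡ sum (map f xs) + sum (map g xs)
  sum-map-+ f g [] = refl
  sum-map-+ f g (x ∷ xs) =
    trans (cong (f x + g x +_) (sum-map-+ f g xs)) (+-interchange (f x) (g x) _ _)

  sum-map-0 : (f : A → ℕ) → (∀ x → f x ≡ 0) → ∀ xs → sum (map f xs) ≡ 0
  sum-map-0 f f≡0 [] = refl
  sum-map-0 f f≡0 (x ∷ xs) = cong₂ _+_ (f≡0 x) (sum-map-0 f f≡0 xs)

module _ {A : Set} (w : A → ℕ) where

  ∈⇒≤sum : ∀ {x xs} → x ∈ xs → w x ≤ sum (map w xs)
  ∈⇒≤sum (here refl) = m≤m+n _ _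
  ∈⇒≤sum {xs = y ∷ _} (there x∈xs) = ≤-trans (∈⇒≤sum x∈xs) (m≤n+m _ (w y))

  ∈₂⇒≤sum : ∀ {x y xs} → x ≢ y → x ∈ xs → y ∈ xs → w x + w y ≤ sum (map w xs)
  ∈₂⇒≤sum x≢y (here refl) (here refl) = ⊥-elim (x≢y refl)
  ∈₂⇒≤sum x≢y (here refl) (there y∈xs) = +-monoʳ-≤ (w _) (∈⇒≤sum y∈xs)
  ∈₂⇒≤sum {x} {y} x≢y (there x∈xs) (here refl) = ≤-trans (≤-reflexive (+-comm (w x) (w y))) (+-monoʳ-≤ (w y) (∈⇒≤sum x∈xs))
  ∈₂⇒≤sum {xs = z ∷ _} x≢y (there x∈xs) (there y∈xs) = ≤-trans (∈₂⇒≤sum x≢y x∈xs y∈xs) (m≤n+m _ (w z))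

  Descending : List A → Set
  Descending = Linked (λ x y → w y ≤ w x)

  head-≥ : ∀ {x z xs} → Descending (z ∷ xs) → x ∈ xs → w x ≤ w z
  head-≥ desc x∈xs with Linked⇒AllPairs (λ p q → ≤-trans q p) desc
  ... | below-z AllPairs.∷ _ = All.lookup below-z x∈xs

  sum<w+w⇒head≡ : ∀ {x z xs} → Descending (z ∷ xs) → x ∈ z ∷ xs →
    sum (map w (z ∷ xs)) < w x + w x → z ≡ x
  sum<w+w⇒head≡ desc (here refl) _ = refl
  sum<w+w⇒head≡ desc (there x∈xs) light = ⊥-elim (<⇒≱ light (+-mono-≤ (head-≥ desc x∈xs) (∈⇒≤sum x∈xs)))

  sum<w+w+lighter⇒head≡ : ∀ {x y z xs} → Descending (z ∷ xs) → x ∈ z ∷ xs → y ∈ z ∷ xs → x ≢ y → w y < w x →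
    sum (map w (z ∷ xs)) < w x + w x + w y → z ≡ x
  sum<w+w+lighter⇒head≡ desc (here refl) _ _ _ _ = refl
  sum<w+w+lighter⇒head≡ desc (there x∈xs) (here refl) _ y<x _ = ⊥-elim (<⇒≱ y<x (head-≥ desc x∈xs))
  sum<w+w+lighter⇒head≡ {x} {y} desc (there x∈xs) (there y∈xs) x≢y _ light =
    ⊥-elim (<⇒≱ light (≤-trans (≤-reflexive (+-assoc (w x) (w x) (w y)))
                                (+-mono-≤ (head-≥ desc x∈xs) (∈₂⇒≤sum x≢y x∈xs y∈xs))))

  descending-prefix≡ : ∀ {x y xs} → Descending xs → x ∈ xs → y ∈ xs → x ≢ y → w y < w x →
    sum (map w xs) < w x + w x + w y → sum (map w xs) < w x + w y + w y → ∃ λ rest → xs ≡ x ∷ y ∷ rest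
  descending-prefix≡ {xs = _ ∷ []} _ (here refl) (here refl) x≢y _ _ _ = ⊥-elim (x≢y refl)
  descending-prefix≡ {x} {y} {xs = _ ∷ _ ∷ rest} desc x∈ y∈ x≢y y<x light₁ light₂
    with refl ← sum<w+w+lighter⇒head≡ desc x∈ y∈ x≢y y<x light₁
    with refl ← sum<w+w⇒head≡ (Linked.tail desc) (Any.tail (x≢y ∘ sym) y∈)
                  (+-cancelˡ-< (w x) _ _ (≤-trans light₂ (≤-reflexive (+-assoc (w x) (w y) (w y)))))
    = rest , refl

module _ {A : Set} (_≟ᴬ_ : DecidableEquality A) where

  sum-indicator-∉ : ∀ n {x xs} → x ∉ xs → sum (map (λ i → if ⌊ i ≟ᴬ x ⌋ then n else 0) xs) ≡ 0
  sum-indicator-∉ n {xs = []} _ = refl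
  sum-indicator-∉ n {x} {y ∷ xs} x∉ with y ≟ᴬ x
  ... | yes refl = ⊥-elim (x∉ (here refl))
  ... | no _ = sum-indicator-∉ n (x∉ ∘ there)

  sum-indicator : ∀ n {x xs} → Unique xs → x ∈ xs → sum (map (λ i → if ⌊ i ≟ᴬ x ⌋ then n else 0) xs) ≡ n
  sum-indicator n {x} (x∉xs AllPairs.∷ _) (here refl) with x ≟ᴬ x
  ... | yes _ = trans (cong (n +_) (sum-indicator-∉ n λ x∈xs → All.lookup x∉xs x∈xs refl)) (+-identityʳ n)
  ... | no x≢x = ⊥-elim (x≢x refl)
  sum-indicator n {x} {y ∷ _} (y∉xs AllPairs.∷ u) (there x∈xs) with y ≟ᴬ x
  ... | yes refl = ⊥-elim (All.lookup y∉xs x∈xs refl)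
  ... | no _ = sum-indicator n u x∈xs

module _ {α h : ℕ} where

  _≟ᴵ_ : DecidableEquality (Item α h)
  o i ≟ᴵ o j = map′ (cong o) (λ { refl → refl }) (i ≟ᶠ j)
  a i ≟ᴵ a j = map′ (cong a) (λ { refl → refl }) (i ≟ᶠ j)
  b i ≟ᴵ b j = map′ (cong b) (λ { refl → refl }) (i ≟ᶠ j)
  c i ≟ᴵ c j = map′ (cong c) (λ { refl → refl }) (i ≟ᶠ j)
  o _ ≟ᴵ a _ = no λ ()
  o _ ≟ᴵ b _ = no λ ()
  o _ ≟ᴵ c _ = no λ ()
  a _ ≟ᴵ o _ = no λ ()
  a _ ≟ᴵ b _ = no λ ()
  a _ ≟ᴵ c _ = no λ ()
  b _ ≟ᴵ o _ = no λ ()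
  b _ ≟ᴵ a _ = no λ ()
  b _ ≟ᴵ c _ = no λ ()
  c _ ≟ᴵ o _ = no λ ()
  c _ ≟ᴵ a _ = no λ ()
  c _ ≟ᴵ b _ = no λ ()

  triple : Fin h → List (Item α h)
  triple k = a k ∷ b k ∷ c k ∷ []

  tripleIndex : Item α h → Maybe (Fin h)
  tripleIndex (o _) = nothing
  tripleIndex (a k) = just k
  tripleIndex (b k) = just k
  tripleIndex (c k) = just k

  ∈-triple⇒tripleIndex : ∀ {v k} → v ∈ triple k → tripleIndex v ≡ just k
  ∈-triple⇒tripleIndex (here refl) = refl
  ∈-triple⇒tripleIndex (there (here refl)) = refl
  ∈-triple⇒tripleIndex (there (there (here refl))) = refl

  triple-disjoint : ∀ {k k′} → k ≢ k′ → Disjoint (triple k) (triple k′)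
  triple-disjoint k≢k′ (v∈k , v∈k′) =
    k≢k′ (just-injective (trans (sym (∈-triple⇒tripleIndex v∈k)) (∈-triple⇒tripleIndex v∈k′)))

  o∉triples : ∀ {i} ks → o i ∉ concatMap triple ks
  o∉triples (k ∷ ks) o∈ with ∈-++⁻ (triple k) o∈
  ... | inj₁ o∈k = case ∈-triple⇒tripleIndex o∈k of λ ()
  ... | inj₂ o∈ks = o∉triples ks o∈ks

  allItems-unique : Unique (allItems α h)
  allItems-unique = ++⁺ (map⁺ (λ { refl → refl }) (allFin⁺ α)) triples-unique os-triples-disjoint
    where
    triples-unique : Unique (concatMap triple (allFin h))
    triples-unique = concat⁺ (All.map⁺ (All.universal (λ _ → triple-unique) (allFin h)))
                             (AllPairs.map⁺ (AllPairs.map triple-disjoint (allFin⁺ h)))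
      where
      triple-unique : ∀ {k} → Unique (triple k)
      triple-unique = ((λ ()) All.∷ (λ ()) All.∷ All.[]) AllPairs.∷ ((λ ()) All.∷ All.[]) AllPairs.∷ All.[] AllPairs.∷ AllPairs.[]
    os-triples-disjoint : Disjoint (map o (allFin α)) (concatMap triple (allFin h))
    os-triples-disjoint (v∈os , v∈ts) with ∈-map⁻ o v∈os
    ... | _ , _ , refl = o∉triples (allFin h) v∈ts

  ∈-allItems : ∀ i → i ∈ allItems α h
  ∈-allItems (o i) = ∈-++⁺ˡ (∈-map⁺ o (∈-allFin i))
  ∈-allItems (a k) = ∈-++⁺ʳ _ (∈-concat⁺′ (here refl) (∈-map⁺ triple (∈-allFin k)))
  ∈-allItems (b k) = ∈-++⁺ʳ _ (∈-concat⁺′ (there (here refl)) (∈-map⁺ triple (∈-allFin k)))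
  ∈-allItems (c k) = ∈-++⁺ʳ _ (∈-concat⁺′ (there (there (here refl))) (∈-map⁺ triple (∈-allFin k)))

  _─_ : Subset α h → Item α h → Subset α h
  (P ─ x) i = P i ∧ not ⌊ i ≟ᴵ x ⌋

  ─-true⁺ : ∀ {P x i} → P i ≡ true → i ≢ x → (P ─ x) i ≡ true
  ─-true⁺ {x = x} {i} Pi i≢x with i ≟ᴵ x
  ... | yes i≡x = ⊥-elim (i≢x i≡x)
  ... | no _ = trans (∧-identityʳ _) Pi

  ─-true⁻ : ∀ {P x i} → (P ─ x) i ≡ true → P i ≡ true × i ≢ x
  ─-true⁻ {P} {x} {i} P─xi with P i | i ≟ᴵ x
  ... | true | no i≢x = refl , i≢x
  ... | true | yes _ = case P─xi of λ ()
  ... | false | _ = case P─xi of λ ()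

  Enumerates : Subset α h → List (Item α h) → Set
  Enumerates P t = ∀ i → (i ∈ t → P i ≡ true) × (P i ≡ true → i ∈ t)

  module _ (w : Item α h → ℕ) where

    weightOf-∅ : ∀ {P} → (∀ i → P i ≢ true) → weightOf w P ≡ 0
    weightOf-∅ {P} P≢true = sum-map-0 _ if-false (allItems α h)
      where
      if-false : ∀ i → (if P i then w i else 0) ≡ 0
      if-false i with P i in Pi
      ... | true = ⊥-elim (P≢true i Pi)
      ... | false = refl

    weightOf-─ : ∀ {P x} → P x ≡ true → weightOf w P ≡ w x + weightOf w (P ─ x)
    weightOf-─ {P} {x} Px = begin
      weightOf w P
        ≡⟨ cong sum (map-cong split (allItems α h)) ⟩
      sum (map (λ i → indicator i + weightIn (P ─ x) i) (allItems α h))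
        ≡⟨ sum-map-+ indicator (weightIn (P ─ x)) (allItems α h) ⟩
      sum (map indicator (allItems α h)) + weightOf w (P ─ x)
        ≡⟨ cong (_+ weightOf w (P ─ x)) count-x ⟩
      w x + weightOf w (P ─ x)
        ∎
      where
      indicator : Item α h → ℕ
      indicator i = if ⌊ i ≟ᴵ x ⌋ then w x else 0
      weightIn : Subset α h → Item α h → ℕ
      weightIn S i = if S i then w i else 0
      split : ∀ i → weightIn P i ≡ indicator i + weightIn (P ─ x) i
      split i with i ≟ᴵ x
      ... | yes refl rewrite Px = sym (+-identityʳ (w i))
      ... | no _ rewrite ∧-identityʳ (P i) = refl
      count-x : sum (map indicator (allItems α h)) ≡ w x
      count-x = sum-indicator _≟ᴵ_ (w x) allItems-unique (∈-allItems x)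

    sum-enumeration : ∀ {P t} → Unique t → Enumerates P t → sum (map w t) ≡ weightOf w P
    sum-enumeration {P} {[]} _ enum = sym (weightOf-∅ (λ i Pi → case proj₂ (enum i) Pi of λ ()))
    sum-enumeration {P} {x ∷ t} (x∉t AllPairs.∷ t-unique) enum = begin
      w x + sum (map w t)      ≡⟨ cong (w x +_) (sum-enumeration t-unique enum-─) ⟩
      w x + weightOf w (P ─ x) ≡⟨ weightOf-─ (proj₁ (enum x) (here refl)) ⟨
      weightOf w P             ∎
      where
      enum-─ : Enumerates (P ─ x) t
      enum-─ i = (λ i∈t → ─-true⁺ {P} (proj₁ (enum i) (there i∈t)) (λ i≡x → All.lookup x∉t i∈t (sym i≡x)))
               , (λ P─xi → let Pi , i≢x = ─-true⁻ {P} P─xi in Any.tail i≢x (proj₂ (enum i) Pi))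

    weightOf-─₂ : ∀ {P x y} → P x ≡ true → P y ≡ true → y ≢ x →
      weightOf w P ≡ w x + w y + weightOf w ((P ─ x) ─ y)
    weightOf-─₂ {P} {x} {y} Px Py y≢x = begin
      weightOf w P                              ≡⟨ weightOf-─ Px ⟩
      w x + weightOf w (P ─ x)                  ≡⟨ cong (w x +_) (weightOf-─ (─-true⁺ {P} Py y≢x)) ⟩
      w x + (w y + weightOf w ((P ─ x) ─ y))    ≡⟨ +-assoc (w x) (w y) _ ⟨
      w x + w y + weightOf w ((P ─ x) ─ y)      ∎

    suffix-after-prefix : ∀ {x y v W t} → (∃ λ rest → t ≡ x ∷ y ∷ rest) → 0 < v →
      sum (map w t) ≡ W → w x + w y + v ≡ W → HasSuffixOfWeight w t v
    suffix-after-prefix {x} {y} {v} (rest , refl) 0<v sum≡W xyv≡W =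
      (x ∷ y ∷ []) , rest , refl , rest≢[] , rest-weight
      where
      rest-weight : sum (map w rest) ≡ v
      rest-weight = +-cancelˡ-≡ (w x + w y) _ _ (trans (+-assoc (w x) (w y) _) (trans sum≡W (sym xyv≡W)))
      rest≢[] : rest ≢ []
      rest≢[] rest≡[] = <⇒≢ 0<v (trans (sym (cong (sum ∘ map w) rest≡[])) rest-weight)

TripleFreeFullPattern : ∀ {α h} → (Item α h → ℕ) → ℕ → Fin h → Set
TripleFreeFullPattern {α} {h} w W k =
  Σ (Subset α h) λ P → FullPattern w W P × P (a k) ≡ true × (∀ i → P i ≡ true → i ≢ a k → ¬ InTriple k i)

b-or-c∈full-pattern : ∀ {α h} {w : Item α h → ℕ} {W k P} → ¬ TripleFreeFullPattern w W k →
  FullPattern w W P → P (a k) ≡ true → P (b k) ≡ true ⊎ P (c k) ≡ true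
b-or-c∈full-pattern {k = k} {P} no-triple-free full Pa with P (b k) in Pb | P (c k) in Pc
... | true | _ = inj₁ refl
... | false | true = inj₂ refl
... | false | false = ⊥-elim (no-triple-free (P , full , Pa , avoids-triple))
  where
  avoids-triple : ∀ i → P i ≡ true → i ≢ a k → ¬ InTriple k i
  avoids-triple i _ i≢a (inj₁ i≡a) = i≢a i≡a
  avoids-triple _ Pi _ (inj₂ (inj₁ refl)) = case trans (sym Pi) Pb of λ ()
  avoids-triple _ Pi _ (inj₂ (inj₂ refl)) = case trans (sym Pi) Pc of λ ()

lemma5 : ∀ (α β h : ℕ) (w : Item α h → ℕ) (W : ℕ) →
    IsANI α β h w W →
    (∀ k → W ≤ 2 * w (a k)) →
    (∀ k → w (b k) < w (a k)) →
    (∀ k → w (c k) ≤ w (b k)) →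
    ∀ (k : Fin h) →
    ¬ (Σ (Subset α h) λ P → FullPattern w W P × P (a k) ≡ true ×
         (∀ i → P i ≡ true → i ≢ a k → ¬ InTriple k i)) →
    (∀ (P : Subset α h) → FullPattern w W P → P (a k) ≡ true →
        (∃ λ i → i ≢ a k × P i ≡ true × w i ≡ w (c k)) ⊎
        (∀ (t : List (Item α h)) → OrderedTuple w P t →
           HasSuffixOfWeight w t (w (c k))))
    × Mandatory w W (w (c k)) (a k)
lemma5 α β h w W (_ , positive , _ , _ , _ , triple-fills , _) W≤2a b<a c≤b k no-triple-free =
  c-or-suffix , c-mandatory
  where
  A = w (a k)
  B = w (b k)
  C = w (c k)

  below-2a+b : W < A + A + B
  below-2a+b = ≤-<-trans (subst (W ≤_) (cong (A +_) (+-identityʳ A)) (W≤2a k)) (m<m+n (A + A) (positive (b k)))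

  c-or-suffix : ∀ P → FullPattern w W P → P (a k) ≡ true →
    (∃ λ i → i ≢ a k × P i ≡ true × w i ≡ C) ⊎ (∀ t → OrderedTuple w P t → HasSuffixOfWeight w t C)
  c-or-suffix P full Pa with b-or-c∈full-pattern no-triple-free full Pa
  ... | inj₂ Pc = inj₁ (c k , (λ ()) , Pc , refl)
  ... | inj₁ Pb with C ≟ B
  ...   | yes C≡B = inj₁ (b k , (λ ()) , Pb , sym C≡B)
  ...   | no C≢B = inj₂ λ t (t-unique , enum , desc) →
    let sum≡W = trans (sum-enumeration w t-unique enum) full
        below-a+2b = subst (_< A + B + B) (triple-fills k) (+-monoʳ-< (A + B) (≤∧≢⇒< (c≤b k) C≢B))
        ab-first = descending-prefix≡ w desc (proj₂ (enum (a k)) Pa) (proj₂ (enum (b k)) Pb) (λ ()) (b<a k)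
                     (≤-<-trans (≤-reflexive sum≡W) below-2a+b) (≤-<-trans (≤-reflexive sum≡W) below-a+2b)
    in suffix-after-prefix w ab-first (positive (c k)) sum≡W (triple-fills k)

  c-mandatory : Mandatory w W C (a k)
  c-mandatory P full Pa with b-or-c∈full-pattern no-triple-free full Pa
  ... | inj₂ Pc = inj₁ (c k , (λ ()) , Pc , refl)
  ... | inj₁ Pb = inj₂ ((P ─ a k) ─ b k , (λ _ → ─-true⁻ {P = P} ∘ proj₁ ∘ ─-true⁻ {P = P ─ a k}) , rest-weight)
    where
    rest-weight : weightOf w ((P ─ a k) ─ b k) ≡ C
    rest-weight = +-cancelˡ-≡ (A + B) _ _ (trans (sym (weightOf-─₂ w Pa Pb (λ ()))) (trans full (sym (triple-fills k))))
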